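{- Using a parallel mechanical matrix-vector processor (MVP), the Boolean product $AB$ of two Boolean $n\times n$ matrices $A$ and $B$ (with $(AB)[i,j]=\bigvee_{k=1}^n(A[i,k]\wedge B[k,j])$) can be computed in $O(n)$ parallel steps, each using $O(n)$ operations.
   Context: A matrix-vector processor (MVP) has an input $n\times n$ Boolean array whose columns can be active or not active, an input $n$-dimensional Boolean vector, and an output $n$-dimensional Boolean vector. A parallel mechanical MVP is one in which: deactivating all columns can be done in one parallel step and activating exactly the columns $j$ with input-vector coordinate $1$ can be done in one parallel step, each using $O(n)$ operations; setting all $n$ output coordinates (the $i$-th to $1$ iff row $i$ of the input array has a $1$ in an active column, else $0$) is done in one parallel step using $O(n)$ operations; resetting the output vector is one parallel step with $O(n)$ operations; reading an input vector is one parallel step with $O(n)$ operations; and reading an $n\times n$ input matrix into the input array takes $O(n)$ parallel steps each using $O(n)$ operations. -}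

module Defs where

open import Data.Nat using (ℕ; _+_; _*_)
open import Data.Bool using (Bool; true; false; _∧_; _∨_)
open import Data.Fin using (Fin)
open import Data.List using (List; []; _∷_; map; allFin)
open import Data.Bool.ListAction using (or)
open import Data.Nat.ListAction using (sum)
open import Data.Product using (_×_; _,_; proj₁; proj₂)
open import Relation.Binary.PropositionalEquality using (_≡_)

BMat : ℕ → Set
BMat n = Fin n → Fin n → Bool

BVec : ℕ → Set
BVec n = Fin n → Bool

boolProd : ∀ {n} → BMat n → BMat n → BMat n
boolProd {n} A B i j = or (map (λ k → A i k ∧ B k j) (allFin n))

data Src : Set where
  srcA srcB : Src

pick : ∀ {n} → Src → BMat n → BMat n → BMat n
pick srcA A B = A
pick srcB A B = B

-- Every instruction uses O(n) operations per parallel step by the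
-- definition of a parallel mechanical MVP; parallel-step costs are given by 'cost'.
data Instr (n : ℕ) : Set where
  deactivateAll : Instr n
  activateByInput : Instr n
  setOutput : Instr n
  resetOutput : Instr n
  readVector : Src → Fin n → Instr n
  readMatrix : Src → Instr n

cost : ∀ {n} → Instr n → ℕ
cost {n} (readMatrix _) = n
cost _ = 1

totalCost : ∀ {n} → List (Instr n) → ℕ
totalCost is = sum (map cost is)

record MVPState (n : ℕ) : Set where
  constructor mk
  field
    array  : BMat n
    active : BVec n
    input  : BVec n
    output : BVec n

initState : ∀ n → MVPState n
initState n = mk (λ _ _ → false) (λ _ → false) (λ _ → false) (λ _ → false)

orActive : ∀ {n} → BMat n → BVec n → Fin n → Bool
orActive {n} M act i = or (map (λ j → act j ∧ M i j) (allFin n))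

step : ∀ {n} → BMat n → BMat n → Instr n → MVPState n → MVPState n
step A B deactivateAll (mk M a v o) = mk M (λ _ → false) v o
step A B activateByInput (mk M a v o) = mk M v v o
step A B setOutput (mk M a v o) = mk M a v (orActive M a)
step A B resetOutput (mk M a v o) = mk M a v (λ _ → false)
step A B (readVector s j) (mk M a v o) = mk M a (λ k → pick s A B k j) o
step A B (readMatrix s) (mk M a v o) = mk (pick s A B) a v o

-- Run a program; the result is the list of output vectors, one
-- snapshot after each 'setOutput' step (what the host reads off).
run : ∀ {n} → BMat n → BMat n → List (Instr n) → MVPState n → List (BVec n)
run A B [] s = []
run A B (setOutput ∷ is) s =
  let s' = step A B setOutput s in MVPState.output s' ∷ run A B is s'
run A B (i ∷ is) s = run A B is (step A B i s)

outputs : ∀ {n} → BMat n → BMat n → List (Instr n) → List (BVec n)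
outputs {n} A B p = run A B p (initState n)

_≗ᵥ_ : ∀ {n} → BVec n → BVec n → Set
_≗ᵥ_ {n} u v = ∀ i → u i ≡ v i

columnsOf : ∀ {n} → BMat n → List (BVec n)
columnsOf {n} C = map (λ j i → C i j) (allFin n)

module Submission where

-- The MVP multiplies a Boolean matrix by a Boolean vector in O(1) parallel
-- steps once the matrix sits in its input array.  Hence AB is computed
-- column by column: read A into the array once (n steps), then for every
-- column j of B run the four-step block
--     read column j of B, deactivate all columns,
--     activate the columns selected by the input, set the output,
-- whose output is A·(column j of B) = column j of AB.  Total cost 5n.

open import Defs
open import Data.Nat using (ℕ; _+_; _*_; _≤_)
open import Data.Nat.Properties using (≤-reflexive; +-identityʳ; *-suc)
open import Data.Bool using (_∧_)
open import Data.Bool.Properties using (∧-comm)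
open import Data.Bool.ListAction using (or)
open import Data.Fin using (Fin)
open import Data.List using (List; []; _∷_; map; allFin; length)
open import Data.List.Properties using (map-cong; length-tabulate)
open import Data.List.Relation.Binary.Pointwise using (Pointwise; []; _∷_)
open import Data.Product using (Σ; _×_; _,_)
open import Function using (id)
open import Relation.Binary.PropositionalEquality using (_≡_; refl; cong; module ≡-Reasoning)

matVec : ∀ {n} → BMat n → BVec n → BVec n
matVec {n} M v i = or (map (λ k → M i k ∧ v k) (allFin n))

orActive-is-product : ∀ {n} (M : BMat n) (v : BVec n) → orActive M v ≗ᵥ matVec M v
orActive-is-product {n} M v i = cong or (map-cong (λ k → ∧-comm (v k) (M i k)) (allFin n))

columnBlock : ∀ {n} → Fin n → List (Instr n) → List (Instr n)
columnBlock j rest = readVector srcB j ∷ deactivateAll ∷ activateByInput ∷ setOutput ∷ rest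

columnsProgram : ∀ {n} → List (Fin n) → List (Instr n)
columnsProgram []       = []
columnsProgram (j ∷ js) = columnBlock j (columnsProgram js)

productProgram : (n : ℕ) → List (Instr n)
productProgram n = readMatrix srcA ∷ columnsProgram (allFin n)

columnsProgram-cost : ∀ {n} (js : List (Fin n)) → totalCost (columnsProgram js) ≡ 4 * length js
columnsProgram-cost []       = refl
columnsProgram-cost (j ∷ js) = begin
  4 + totalCost (columnsProgram js) ≡⟨ cong (4 +_) (columnsProgram-cost js) ⟩
  4 + 4 * length js                 ≡⟨ *-suc 4 (length js) ⟨
  4 * length (j ∷ js)               ∎
  where open ≡-Reasoning

productProgram-cost : ∀ n → totalCost (productProgram n) ≤ 5 * n + 0
productProgram-cost n = ≤-reflexive (begin
  n + totalCost (columnsProgram (allFin n)) ≡⟨ cong (n +_) (columnsProgram-cost (allFin n)) ⟩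
  n + 4 * length (allFin n)                ≡⟨ cong (λ m → n + 4 * m) (length-tabulate {n = n} id) ⟩
  5 * n                                    ≡⟨ +-identityʳ (5 * n) ⟨
  5 * n + 0                                ∎)
  where open ≡-Reasoning

column : ∀ {n} → BMat n → Fin n → BVec n
column B j k = B k j

-- Starting with A in the array, the block program for the indices js
-- emits the vectors A·(column j of B) for j in js, in order: block j
-- loads column j of B as the input, activates the columns it selects and
-- outputs their disjunction, i.e. A·(column j of B); the array keeps A.
columnsProgram-outputs : ∀ {n} (A B : BMat n) (js : List (Fin n)) a v o →
  Pointwise _≗ᵥ_ (run A B (columnsProgram js) (mk A a v o)) (map (λ j → matVec A (column B j)) js)
columnsProgram-outputs A B []       a v o = []
columnsProgram-outputs A B (j ∷ js) a v o =
  orActive-is-product A (column B j) ∷ columnsProgram-outputs A B js _ _ _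

theorem2 : Σ ℕ λ c → Σ ℕ λ d → Σ ((n : ℕ) → List (Instr n)) λ P →
    (∀ n → totalCost (P n) ≤ c * n + d)
    × (∀ n (A B : BMat n) → Pointwise _≗ᵥ_ (outputs A B (P n)) (columnsOf (boolProd A B)))
theorem2 = 5 , 0 , productProgram , productProgram-cost , outputsAreColumns
  where
  -- After 'readMatrix srcA' the array holds A, and A·(column j of B) is
  -- column j of AB by definition of the Boolean product.
  outputsAreColumns : ∀ n (A B : BMat n) →
    Pointwise _≗ᵥ_ (outputs A B (productProgram n)) (columnsOf (boolProd A B))
  outputsAreColumns n A B = columnsProgram-outputs A B (allFin n) _ _ _
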